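{- $21 \leq R_{3}(L) \leq 2593$. In particular, there exists a $3$-coloring of the grid $[20]\times[20]$ containing no monochromatic $L$, and every $3$-coloring of $[2593]\times[2593]$ contains a monochromatic $L$.
   Context: For $n\in\mathbb{N}$, $[n]=\{1,\dots,n\}$. A $c$-coloring of the grid $[n]\times[n]$ is a function $[n]\times[n]\to[c]$. An $L$ in the grid is a set of three lattice points of the form $\{(i,j),(i,j+t),(i+t,j+t)\}$ with $t$ a positive integer, all lying in $[n]\times[n]$. It is monochromatic if all three points receive the same color. For a positive integer $c$, $R_c(L)$ denotes the least $n$ such that every $c$-coloring of $[n]\times[n]$ contains a monochromatic $L$ (such $n$ is known to exist). -}

module Defs where

open import Data.Nat using (ℕ; zero; suc; _+_; _<_; _≤_)
open import Data.Fin using (Fin)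
open import Data.Product using (Σ; ∃; _×_; _,_)
open import Relation.Binary.PropositionalEquality using (_≡_)
open import Relation.Nullary using (¬_)

-- Grid [n]×[n] is represented 0-indexed: the lattice point (i,j) ∈ [n]×[n]
-- corresponds to (i-1, j-1) with 0 ≤ i-1, j-1 < n.
Coloring : ℕ → ℕ → Set
Coloring c n = (i j : ℕ) → i < n → j < n → Fin c

record MonoL {c n : ℕ} (χ : Coloring c n) : Set where
  field
    i j t : ℕ
    t≥1   : 1 ≤ t
    i<n   : i < n
    j<n   : j < n
    i+t<n : i + t < n
    j+t<n : j + t < n
    col₁  : χ i j i<n j<n ≡ χ i (j + t) i<n j+t<n
    col₂  : χ i (j + t) i<n j+t<n ≡ χ (i + t) (j + t) i+t<n j+t<n

HasLProperty : ℕ → ℕ → Set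
HasLProperty c n = (χ : Coloring c n) → MonoL χ

IsRcL : ℕ → ℕ → Set
IsRcL c r = HasLProperty c r × ((m : ℕ) → m < r → ¬ HasLProperty c m)

{-# OPTIONS --safe #-}
module Submission where

open import Defs
open import Data.Bool using (Bool; true; false; T; _∧_)
open import Data.Bool.Properties using (T-∧)
open import Data.Empty using (⊥)
open import Data.Fin using (Fin; zero; suc; toℕ; fromℕ; inject₁; punchIn)
open import Data.Fin.Properties using (_≟_; toℕ<n; toℕ-inject₁; toℕ-fromℕ; punchInᵢ≢i; punchOut-injective)
open import Data.List using (List; []; _∷_)
open import Data.Nat using (ℕ; zero; suc; _+_; _*_; _∸_; _<_; _≤_; z≤n; s≤s; _<?_; _≤?_)
open import Data.Nat.DivMod using (_mod_)
open import Data.Nat.Properties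
  using ( +-*-semiring; +-identityʳ; +-suc; +-comm; +-assoc; +-cancelʳ-≡; +-cancelˡ-<; +-monoˡ-≤
        ; *-zeroʳ; *-mono-≤; *-cancelˡ-<; ≤-pred; <⇒≤; ≮⇒≥; ≰⇒>; ≤-<-trans; <-≤-trans; <-trans
        ; m≤m+n; m≤n+m; m+[n∸m]≡n; m<n⇒0<n∸m; <-irrelevant; anyUpTo? )
open import Data.Nat.Tactic.RingSolver using (solve)
open import Algebra.Properties.Semiring.Sum +-*-semiring
  using (sum; ∑-comm; *-distribˡ-sum; sum-cong-≗; sum-init-last; sum-remove; sum-replicate-zero)
open import Data.Product using (Σ; ∃; ∃₂; _×_; _,_)
open import Data.Vec.Functional using (Vector; removeAt)
open import Function using (_∘_; Equivalence)
open import Relation.Binary.PropositionalEquality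
open import Relation.Nullary using (¬_; Dec; yes; no; does; contradiction)
open import Relation.Nullary.Decidable using (_×-dec_; map′; from-yes; from-no; decidable-stable)

-- Lower bound: the colouring of [20]² tabulated below has no monochromatic L, which an
-- exhaustive search confirms.
--
-- Upper bound: suppose a 3-colouring of [2593]² has no monochromatic L.  Some colour c₁
-- occupies at least 865 columns z of row 0; sorting the 865·864/2 pairs of such columns by
-- their difference gives a δ for which more than 144 columns z have colour c₁ at both
-- (0, z − δ) and (0, z).  The point (δ, z) then avoids c₁, so a second colour c₂ occurs at
-- (δ, z) for at least 73 of these columns, and sorting their pairs by difference again gives
-- two pairs w₁ + x = z₁ < z₂ = w₂ + x.  For such columns w + s = z the point (δ + s, z) is the
-- apex of an L based on row 0 (colour c₁) and of one based on row δ (colour c₂), so it has the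
-- third colour.  Hence (δ + x, z₁), (δ + x, z₂) and (δ + x + (z₂ − z₁), z₂) form a
-- monochromatic L.

𝟙 : Bool → ℕ
𝟙 false = 0
𝟙 true  = 1

𝟙-∧ : ∀ a b → 𝟙 (a ∧ b) ≡ 𝟙 a * 𝟙 b
𝟙-∧ false b = refl
𝟙-∧ true  b = sym (+-identityʳ (𝟙 b))

𝟙>0⇒T : ∀ {a} → 0 < 𝟙 a → T a
𝟙>0⇒T {true} _ = _

¬T⇒𝟙≡0 : ∀ {a} → ¬ T a → 𝟙 a ≡ 0
¬T⇒𝟙≡0 {false} _ = refl
¬T⇒𝟙≡0 {true}  a≢ = contradiction _ a≢

sum-last : ∀ n (f : ℕ → ℕ) → sum {suc n} (f ∘ toℕ) ≡ sum {n} (f ∘ toℕ) + f n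
sum-last n f = begin
  sum {suc n} (f ∘ toℕ)                            ≡⟨ sum-init-last (f ∘ toℕ) ⟩
  sum {n} (f ∘ toℕ ∘ inject₁) + f (toℕ (fromℕ n))  ≡⟨ cong₂ _+_ (sum-cong-≗ {n} (cong f ∘ toℕ-inject₁))
                                                               (cong f (toℕ-fromℕ n)) ⟩
  sum {n} (f ∘ toℕ) + f n                          ∎
  where open ≡-Reasoning

sum-pigeonhole : ∀ {n b} (s : Vector ℕ n) → n * b < sum s → ∃ λ k → b < s k
sum-pigeonhole {suc n} {b} s hyp with b <? s zero
... | yes b<s₀ = zero , b<s₀
... | no  b≮s₀ = let (k , b<sₖ) = sum-pigeonhole (s ∘ suc) rest in suc k , b<sₖ
  where
  rest : n * b < sum (s ∘ suc)
  rest = +-cancelˡ-< b _ _ (<-≤-trans hyp (+-monoˡ-≤ _ (≮⇒≥ b≮s₀)))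

sum-pigeonhole-avoiding : ∀ {n b} (s : Vector ℕ (suc n)) c₀ → s c₀ ≡ 0 →
                          n * b < sum s → ∃ λ c → c ≢ c₀ × b < s c
sum-pigeonhole-avoiding {n} {b} s c₀ s₀≡0 hyp =
  let (k , b<s) = sum-pigeonhole (removeAt s c₀) (subst (n * b <_) sum≡ hyp)
  in punchIn c₀ k , punchInᵢ≢i c₀ k , b<s
  where
  sum≡ : sum s ≡ sum (removeAt s c₀)
  sum≡ = trans (sum-remove {i = c₀} s) (cong (_+ sum (removeAt s c₀)) s₀≡0)

infixr 7 _∩_
_∩_ : (ℕ → Bool) → (ℕ → Bool) → ℕ → Bool
(A ∩ B) z = A z ∧ B z

∩-member : ∀ {A B : ℕ → Bool} z → T ((A ∩ B) z) → T (A z) × T (B z)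
∩-member {A} {B} z = Equivalence.to (T-∧ {A z} {B z})

count : ℕ → (ℕ → Bool) → ℕ
count n A = sum {n} (𝟙 ∘ A ∘ toℕ)

count-full : ∀ n → count n (λ _ → true) ≡ n
count-full zero    = refl
count-full (suc n) = cong suc (count-full n)

count-empty : ∀ {n} A → (∀ z → z < n → ¬ T (A z)) → count n A ≡ 0
count-empty {n} A empty =
  trans (sum-cong-≗ {n} (λ z → ¬T⇒𝟙≡0 (empty (toℕ z) (toℕ<n z)))) (sum-replicate-zero n)

count>0⇒member : ∀ {n} A → 0 < count n A → ∃ λ z → z < n × T (A z)
count>0⇒member {n} A hyp =
  let (k , 0<) = sum-pigeonhole (𝟙 ∘ A ∘ toℕ) (subst (_< count n A) (sym (*-zeroʳ n)) hyp)
  in toℕ k , toℕ<n k , 𝟙>0⇒T 0<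

count>1⇒two-members : ∀ {n} A → 1 < count n A → ∃₂ λ z₁ z₂ → z₁ < z₂ × z₂ < n × T (A z₁) × T (A z₂)
count>1⇒two-members {suc n} A hyp with A 0 in eq
... | true  = let (z , z<n , z∈A) = count>0⇒member (A ∘ suc) (≤-pred hyp)
              in 0 , suc z , s≤s z≤n , s≤s z<n , subst T (sym eq) _ , z∈A
... | false = let (z₁ , z₂ , z₁<z₂ , z₂<n , z₁∈A , z₂∈A) = count>1⇒two-members (A ∘ suc) hyp
              in suc z₁ , suc z₂ , s≤s z₁<z₂ , s≤s z₂<n , z₁∈A , z₂∈A

class : ∀ {c} → (ℕ → Fin c) → Fin c → ℕ → Bool
class col k z = does (col z ≟ k)

class-member : ∀ {c} (col : ℕ → Fin c) k z → T (class col k z) → col z ≡ k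
class-member col k z with col z ≟ k
... | yes col≡k = λ _ → col≡k
... | no  _     = λ ()

sum-𝟙-≟ : ∀ {c} (x : Fin c) → sum (λ k → 𝟙 (does (x ≟ k))) ≡ 1
sum-𝟙-≟ {suc c} zero    = cong suc (sum-replicate-zero c)
sum-𝟙-≟         (suc x) = sum-𝟙-≟ x

𝟙-by-colour : ∀ {c} b (x : Fin c) → 𝟙 b ≡ sum (λ k → 𝟙 (b ∧ does (x ≟ k)))
𝟙-by-colour {c} false x = sym (sum-replicate-zero c)
𝟙-by-colour     true  x = sym (sum-𝟙-≟ x)

count-by-colour : ∀ {c} n A (col : ℕ → Fin c) → count n A ≡ sum (λ k → count n (A ∩ class col k))
count-by-colour {c} n A col = trans (sum-cong-≗ {n} (λ z → 𝟙-by-colour (A (toℕ z)) (col (toℕ z))))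
                                    (∑-comm {n} {c} (λ z k → 𝟙 ((A ∩ class col k) (toℕ z))))

popular-class : ∀ {c n m} (col : ℕ → Fin c) → c * m < n → ∃ λ k → m < count n (class col k)
popular-class {c} {n} {m} col cm<n =
  sum-pigeonhole {c} (λ k → count n (class col k))
                 (subst (c * m <_) (trans (sym (count-full n)) (count-by-colour n (λ _ → true) col)) cm<n)

popular-class-avoiding : ∀ {c n m} A (col : ℕ → Fin (suc c)) k₀ → (∀ z → z < n → T (A z) → col z ≢ k₀) →
                         c * m < count n A → ∃ λ k → k ≢ k₀ × m < count n (A ∩ class col k)
popular-class-avoiding {c} {n} {m} A col k₀ avoids cm<|A| =
  sum-pigeonhole-avoiding (λ k → count n (A ∩ class col k)) k₀ (count-empty (A ∩ class col k₀) none)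
                          (subst (c * m <_) (count-by-colour n A col) cm<|A|)
  where
  none : ∀ z → z < n → ¬ T ((A ∩ class col k₀) z)
  none z z<n z∈ = let (z∈A , z∈k₀) = ∩-member {A} {class col k₀} z z∈
                  in avoids z z<n z∈A (class-member col k₀ z z∈k₀)

pairs : ℕ → (ℕ → Bool) → ℕ
pairs n A = sum {n} (λ z → 𝟙 (A (toℕ z)) * count (toℕ z) A)

𝟙-square-step : ∀ p s b → 2 * p + s ≡ s * s → 2 * (p + 𝟙 b * s) + (s + 𝟙 b) ≡ (s + 𝟙 b) * (s + 𝟙 b)
𝟙-square-step p s false hyp = begin
  2 * (p + 0 * s) + (s + 0)  ≡⟨ solve (p ∷ s ∷ []) ⟩
  2 * p + s                  ≡⟨ hyp ⟩
  s * s                      ≡⟨ solve (s ∷ []) ⟩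
  (s + 0) * (s + 0)          ∎
  where open ≡-Reasoning
𝟙-square-step p s true  hyp = begin
  2 * (p + 1 * s) + (s + 1)  ≡⟨ solve (p ∷ s ∷ []) ⟩
  (2 * p + s) + (2 * s + 1)  ≡⟨ cong (_+ (2 * s + 1)) hyp ⟩
  s * s + (2 * s + 1)        ≡⟨ solve (s ∷ []) ⟩
  (s + 1) * (s + 1)          ∎
  where open ≡-Reasoning

pairs-identity : ∀ n A → 2 * pairs n A + count n A ≡ count n A * count n A
pairs-identity zero    A = refl
pairs-identity (suc n) A = begin
  2 * pairs (suc n) A + count (suc n) A
    ≡⟨ cong₂ (λ p s → 2 * p + s) (sum-last n (λ z → 𝟙 (A z) * count z A)) (sum-last n (𝟙 ∘ A)) ⟩
  2 * (pairs n A + 𝟙 (A n) * count n A) + (count n A + 𝟙 (A n))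
    ≡⟨ 𝟙-square-step (pairs n A) (count n A) (A n) (pairs-identity n A) ⟩
  (count n A + 𝟙 (A n)) * (count n A + 𝟙 (A n))
    ≡⟨ cong (λ s → s * s) (sum-last n (𝟙 ∘ A)) ⟨
  count (suc n) A * count (suc n) A ∎
  where open ≡-Reasoning

pairs-lower-bound : ∀ {n m} A → suc m ≤ count n A → m * suc m ≤ 2 * pairs n A
pairs-lower-bound {n} {m} A big with count n A | pairs-identity n A
... | suc s | identity = subst (m * suc m ≤_) (sym twice-pairs) (*-mono-≤ m≤s (s≤s m≤s))
  where
  m≤s = ≤-pred big
  twice-pairs : 2 * pairs n A ≡ s * suc s
  twice-pairs = +-cancelʳ-≡ (suc s) _ _ (trans identity (+-comm (suc s) (s * suc s)))

-- The translate A + d, defined without truncated subtraction.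
shift : (ℕ → Bool) → ℕ → ℕ → Bool
shift A zero    z       = A z
shift A (suc d) zero    = false
shift A (suc d) (suc z) = shift A d z

shift-member : ∀ A d z → T (shift A d z) → ∃ λ a → a + d ≡ z × T (A a)
shift-member A zero    z       z∈A = z , +-identityʳ z , z∈A
shift-member A (suc d) (suc z) z∈A+d =
  let (a , a+d≡z , a∈A) = shift-member A d z z∈A+d in a , trans (+-suc a d) (cong suc a+d≡z) , a∈A

sum-shift≡count : ∀ A {n z} → z ≤ n → sum {n} (λ e → 𝟙 (shift A (suc (toℕ e)) z)) ≡ count z A
sum-shift≡count A {n}     {zero}  _         = sum-replicate-zero n
sum-shift≡count A {suc n} {suc z} (s≤s z≤n′) = begin
  𝟙 (A z) + sum {n} (λ e → 𝟙 (shift A (suc (toℕ e)) z))  ≡⟨ cong (𝟙 (A z) +_) (sum-shift≡count A z≤n′) ⟩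
  𝟙 (A z) + count z A                                    ≡⟨ +-comm (𝟙 (A z)) (count z A) ⟩
  count z A + 𝟙 (A z)                                    ≡⟨ sum-last z (𝟙 ∘ A) ⟨
  count (suc z) A                                        ∎
  where open ≡-Reasoning

pairs-by-difference : ∀ n A → sum {n} (λ e → count n (A ∩ shift A (suc (toℕ e)))) ≡ pairs n A
pairs-by-difference n A = begin
  sum {n} (λ e → sum {n} (λ z → 𝟙 ((A ∩ shift A (suc (toℕ e))) (toℕ z))))
    ≡⟨ ∑-comm {n} {n} _ ⟩
  sum {n} (λ z → sum {n} (λ e → 𝟙 ((A ∩ shift A (suc (toℕ e))) (toℕ z))))
    ≡⟨ sum-cong-≗ {n} per-column ⟩
  pairs n A ∎
  where
  open ≡-Reasoning
  per-column : ∀ z → sum {n} (λ e → 𝟙 ((A ∩ shift A (suc (toℕ e))) (toℕ z))) ≡ 𝟙 (A (toℕ z)) * count (toℕ z) A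
  per-column z = begin
    sum {n} (λ e → 𝟙 (A (toℕ z) ∧ shift A (suc (toℕ e)) (toℕ z)))
      ≡⟨ sum-cong-≗ {n} (λ e → 𝟙-∧ (A (toℕ z)) _) ⟩
    sum {n} (λ e → 𝟙 (A (toℕ z)) * 𝟙 (shift A (suc (toℕ e)) (toℕ z)))
      ≡⟨ *-distribˡ-sum {n} (𝟙 (A (toℕ z))) _ ⟨
    𝟙 (A (toℕ z)) * sum {n} (λ e → 𝟙 (shift A (suc (toℕ e)) (toℕ z)))
      ≡⟨ cong (𝟙 (A (toℕ z)) *_) (sum-shift≡count A (<⇒≤ (toℕ<n z))) ⟩
    𝟙 (A (toℕ z)) * count (toℕ z) A ∎

popular-difference : ∀ {n b m} A → 2 * (n * b) < m * suc m → suc m ≤ count n A →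
                     ∃ λ d → 0 < d × b < count n (A ∩ shift A d)
popular-difference {n} {b} {m} A small big =
  let (e , b<) = sum-pigeonhole {n} (λ e → count n (A ∩ shift A (suc (toℕ e)))) many
  in suc (toℕ e) , s≤s z≤n , b<
  where
  many : n * b < sum {n} (λ e → count n (A ∩ shift A (suc (toℕ e))))
  many = subst (n * b <_) (sym (pairs-by-difference n A))
               (*-cancelˡ-< 2 (n * b) (pairs n A) (<-≤-trans small (pairs-lower-bound {n} A big)))

-- Colourings are handled as total functions read on the grid; monochromatic L's in them
-- are decidable (monoL?), so the upper bound may be argued by contradiction.
restrict : ∀ {c} n → (ℕ → ℕ → Fin c) → Coloring c n
restrict n χ i j _ _ = χ i j

monoL : ∀ {c n} (χ : ℕ → ℕ → Fin c) {i j t i′ j′} → i + t ≡ i′ → j + t ≡ j′ → 0 < t →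
        i′ < n → j′ < n → χ i j ≡ χ i j′ → χ i j′ ≡ χ i′ j′ → MonoL (restrict n χ)
monoL χ {i} {j} {t} refl refl t>0 i+t<n j+t<n same₁ same₂ = record
  { i = i ; j = j ; t = t ; t≥1 = t>0
  ; i<n = ≤-<-trans (m≤m+n i t) i+t<n ; j<n = ≤-<-trans (m≤m+n j t) j+t<n
  ; i+t<n = i+t<n ; j+t<n = j+t<n ; col₁ = same₁ ; col₂ = same₂ }

MonoL-mono : ∀ {c m n} {χ : ℕ → ℕ → Fin c} → m ≤ n → MonoL (restrict m χ) → MonoL (restrict n χ)
MonoL-mono {χ = χ} m≤n L =
  monoL χ refl refl t≥1 (<-≤-trans i+t<n m≤n) (<-≤-trans j+t<n m≤n) col₁ col₂
  where open MonoL L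

MonoLAt : ∀ {c} → ℕ → (ℕ → ℕ → Fin c) → ℕ → ℕ → ℕ → Set
MonoLAt n χ i j t =
  0 < t × i + t < n × j + t < n × χ i j ≡ χ i (j + t) × χ i (j + t) ≡ χ (i + t) (j + t)

monoL? : ∀ {c} n (χ : ℕ → ℕ → Fin c) → Dec (MonoL (restrict n χ))
monoL? n χ =
  map′ from-witness to-witness (anyUpTo? (λ i → anyUpTo? (λ j → anyUpTo? (MonoLAt? i j) n) n) n)
  where
  MonoLAt? : ∀ i j t → Dec (MonoLAt n χ i j t)
  MonoLAt? i j t = 0 <? t ×-dec i + t <? n ×-dec j + t <? n
                   ×-dec χ i j ≟ χ i (j + t) ×-dec χ i (j + t) ≟ χ (i + t) (j + t)
  Witness = ∃ λ i → i < n × ∃ λ j → j < n × ∃ λ t → t < n × MonoLAt n χ i j t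
  from-witness : Witness → MonoL (restrict n χ)
  from-witness (i , _ , j , _ , t , _ , t>0 , i+t<n , j+t<n , same₁ , same₂) =
    monoL χ refl refl t>0 i+t<n j+t<n same₁ same₂
  to-witness : MonoL (restrict n χ) → Witness
  to-witness L = i , i<n , j , j<n , t , ≤-<-trans (m≤n+m t i) i+t<n , t≥1 , i+t<n , j+t<n , col₁ , col₂
    where open MonoL L

extend : ∀ {c n} → Coloring (suc c) n → ℕ → ℕ → Fin (suc c)
extend {n = n} χ i j with i <? n | j <? n
... | yes i<n | yes j<n = χ i j i<n j<n
... | _       | _       = zero

extend-agrees : ∀ {c n} (χ : Coloring (suc c) n) {i j} (i<n : i < n) (j<n : j < n) →
                extend χ i j ≡ χ i j i<n j<n
extend-agrees {n = n} χ {i} {j} i<n j<n with i <? n | j <? n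
... | yes i<n′ | yes j<n′ = cong₂ (χ i j) (<-irrelevant i<n′ i<n) (<-irrelevant j<n′ j<n)
... | yes _    | no  j≮n  = contradiction j<n j≮n
... | no  i≮n  | _        = contradiction i<n i≮n

MonoL-extend : ∀ {c n} (χ : Coloring (suc c) n) → MonoL (restrict n (extend χ)) → MonoL χ
MonoL-extend χ L = record
  { i = i ; j = j ; t = t ; t≥1 = t≥1 ; i<n = i<n ; j<n = j<n ; i+t<n = i+t<n ; j+t<n = j+t<n
  ; col₁ = trans (sym (extend-agrees χ i<n j<n)) (trans col₁ (extend-agrees χ i<n j+t<n))
  ; col₂ = trans (sym (extend-agrees χ i<n j+t<n)) (trans col₂ (extend-agrees χ i+t<n j+t<n)) }
  where open MonoL L

IsRcL-lower : ∀ {c m r} (χ : ℕ → ℕ → Fin c) → ¬ MonoL (restrict m χ) → IsRcL c r → m < r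
IsRcL-lower χ L-free (every , _) = ≰⇒> (λ r≤m → L-free (MonoL-mono r≤m (every (restrict _ χ))))

IsRcL-upper : ∀ {c n r} → HasLProperty c n → IsRcL c r → r ≤ n
IsRcL-upper every (_ , minimal) = ≮⇒≥ (λ n<r → minimal _ n<r every)

Fin2-≢⇒≡ : ∀ {x y z : Fin 2} → x ≢ z → y ≢ z → x ≡ y
Fin2-≢⇒≡ {zero}     {zero}               _   _   = refl
Fin2-≢⇒≡ {suc zero} {suc zero}           _   _   = refl
Fin2-≢⇒≡ {zero}     {suc zero} {zero}     x≢z _   = contradiction refl x≢z
Fin2-≢⇒≡ {zero}     {suc zero} {suc zero} _   y≢z = contradiction refl y≢z
Fin2-≢⇒≡ {suc zero} {zero}     {zero}     _   y≢z = contradiction refl y≢z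
Fin2-≢⇒≡ {suc zero} {zero}     {suc zero} x≢z _   = contradiction refl x≢z

Fin3-≢⇒≡ : ∀ {c d x y : Fin 3} → c ≢ d → x ≢ c → x ≢ d → y ≢ c → y ≢ d → x ≡ y
Fin3-≢⇒≡ c≢d x≢c x≢d y≢c y≢d =
  punchOut-injective c≢x c≢y (Fin2-≢⇒≡ (x≢d ∘ punchOut-injective c≢x c≢d) (y≢d ∘ punchOut-injective c≢y c≢d))
  where
  c≢x = x≢c ∘ sym
  c≢y = y≢c ∘ sym

module _ {N} (χ : ℕ → ℕ → Fin 3) (L-free : ¬ MonoL (restrict N χ)) where

  apex-avoids : ∀ {i j t j′ k} → j + t ≡ j′ → 0 < t → i + t < N → j′ < N →
                χ i j ≡ k → χ i j′ ≡ k → χ (i + t) j′ ≢ k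
  apex-avoids j+t≡j′ t>0 i+t<N j′<N base top apex =
    L-free (monoL χ refl j+t≡j′ t>0 i+t<N j′<N (trans base (sym top)) (trans top (sym apex)))

  -- The corners (0, foot), (0, z), (δ, z) of an L have colours c₁, c₁, c₂.
  record Focused (c₁ c₂ : Fin 3) (δ z : ℕ) : Set where
    field
      foot      : ℕ
      foot+δ    : foot + δ ≡ z
      foot-row₀ : χ 0 foot ≡ c₁
      row₀      : χ 0 z ≡ c₁
      row-δ     : χ δ z ≡ c₂

  module _ {c₁ c₂ : Fin 3} {δ : ℕ} where
    open Focused

    focused-apex-in-grid : ∀ {w s z} → Focused c₁ c₂ δ w → w + s ≡ z → z < N → δ + s < N
    focused-apex-in-grid {w} {s} Fw w+s≡z z<N =
      ≤-<-trans (subst (δ + s ≤_) w+s≡z (+-monoˡ-≤ s (subst (δ ≤_) (foot+δ Fw) (m≤n+m δ (foot Fw))))) z<N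

    apex-avoids-both : ∀ {w s z} → Focused c₁ c₂ δ w → Focused c₁ c₂ δ z → w + s ≡ z → 0 < s → z < N →
                       χ (δ + s) z ≢ c₁ × χ (δ + s) z ≢ c₂
    apex-avoids-both {w} {s} {z} Fw Fz w+s≡z s>0 z<N =
        apex-avoids {i = 0} foot+δ+s≡z (<-≤-trans s>0 (m≤n+m s δ)) apex<N z<N (foot-row₀ Fw) (row₀ Fz)
      , apex-avoids {i = δ} w+s≡z s>0 apex<N z<N (row-δ Fw) (row-δ Fz)
      where
      apex<N = focused-apex-in-grid Fw w+s≡z z<N
      foot+δ+s≡z : foot Fw + (δ + s) ≡ z
      foot+δ+s≡z = trans (sym (+-assoc (foot Fw) δ s)) (trans (cong (_+ s) (foot+δ Fw)) w+s≡z)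

    no-repeated-difference : ∀ {x w₁ z₁ w₂ z₂} → c₁ ≢ c₂ →
      Focused c₁ c₂ δ w₁ → Focused c₁ c₂ δ z₁ → Focused c₁ c₂ δ w₂ → Focused c₁ c₂ δ z₂ →
      w₁ + x ≡ z₁ → w₂ + x ≡ z₂ → 0 < x → z₁ < z₂ → z₂ < N → ⊥
    no-repeated-difference {x} {w₁} {z₁} {w₂} {z₂} c₁≢c₂ Fw₁ Fz₁ Fw₂ Fz₂ w₁+x≡z₁ w₂+x≡z₂ x>0 z₁<z₂ z₂<N
      =
      L-free (monoL χ (+-assoc δ x y) z₁+y≡z₂ y>0 (focused-apex-in-grid Fw₁ w₁+x+y≡z₂ z₂<N) z₂<N
                   (third-colour apex₁ apex₂) (third-colour apex₂ apex₃))
      where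
      y = z₂ ∸ z₁
      z₁+y≡z₂ = m+[n∸m]≡n (<⇒≤ z₁<z₂)
      y>0 = m<n⇒0<n∸m z₁<z₂
      w₁+x+y≡z₂ : w₁ + (x + y) ≡ z₂
      w₁+x+y≡z₂ = trans (sym (+-assoc w₁ x y)) (trans (cong (_+ y) w₁+x≡z₁) z₁+y≡z₂)
      apex₁ = apex-avoids-both Fw₁ Fz₁ w₁+x≡z₁ x>0 (<-trans z₁<z₂ z₂<N)
      apex₂ = apex-avoids-both Fw₂ Fz₂ w₂+x≡z₂ x>0 z₂<N
      apex₃ = apex-avoids-both Fw₁ Fz₂ w₁+x+y≡z₂ (<-≤-trans x>0 (m≤m+n x y)) z₂<N
      third-colour : ∀ {k l} → k ≢ c₁ × k ≢ c₂ → l ≢ c₁ × l ≢ c₂ → k ≡ l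
      third-colour (k≢c₁ , k≢c₂) (l≢c₁ , l≢c₂) = Fin3-≢⇒≡ c₁≢c₂ k≢c₁ k≢c₂ l≢c₁ l≢c₂

    focused-sets-are-small : ∀ {m} B → c₁ ≢ c₂ → (∀ z → T (B z) → Focused c₁ c₂ δ z) →
                             2 * (N * 1) < m * suc m → ¬ suc m ≤ count N B
    focused-sets-are-small B c₁≢c₂ focused small big =
      let (x , x>0 , repeated) = popular-difference {N} B small big
          (z₁ , z₂ , z₁<z₂ , z₂<N , z₁∈ , z₂∈) = count>1⇒two-members (B ∩ shift B x) repeated
          (z₁∈B , z₁∈B+x) = ∩-member {B} {shift B x} z₁ z₁∈
          (z₂∈B , z₂∈B+x) = ∩-member {B} {shift B x} z₂ z₂∈
          (w₁ , w₁+x≡z₁ , w₁∈B) = shift-member B x z₁ z₁∈B+x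
          (w₂ , w₂+x≡z₂ , w₂∈B) = shift-member B x z₂ z₂∈B+x
      in no-repeated-difference c₁≢c₂ (focused w₁ w₁∈B) (focused z₁ z₁∈B)
                                (focused w₂ w₂∈B) (focused z₂ z₂∈B) w₁+x≡z₁ w₂+x≡z₂ x>0 z₁<z₂ z₂<N

  bases : Fin 3 → ℕ → ℕ → Bool
  bases c₁ δ = class (χ 0) c₁ ∩ shift (class (χ 0) c₁) δ

  bases-member : ∀ {c₁ δ z} → T (bases c₁ δ z) → χ 0 z ≡ c₁ × ∃ λ a → a + δ ≡ z × χ 0 a ≡ c₁
  bases-member {c₁} {δ} {z} z∈ =
    let (z∈A , z∈A+δ) = ∩-member {class (χ 0) c₁} {shift (class (χ 0) c₁) δ} z z∈
        (a , a+δ≡z , a∈A) = shift-member (class (χ 0) c₁) δ z z∈A+δ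
    in class-member (χ 0) c₁ z z∈A , a , a+δ≡z , class-member (χ 0) c₁ a a∈A

  row-δ-avoids : ∀ {c₁ δ z} → 0 < δ → z < N → T (bases c₁ δ z) → χ δ z ≢ c₁
  row-δ-avoids {c₁} {δ} {z} δ>0 z<N z∈ =
    let (z-c₁ , a , a+δ≡z , a-c₁) = bases-member {c₁} {δ} z∈
    in apex-avoids {i = 0} a+δ≡z δ>0 (≤-<-trans (subst (δ ≤_) a+δ≡z (m≤n+m δ a)) z<N) z<N a-c₁ z-c₁

  focused-member : ∀ {c₁ c₂ δ} z → T ((bases c₁ δ ∩ class (χ δ) c₂) z) → Focused c₁ c₂ δ z
  focused-member {c₁} {c₂} {δ} z z∈ =
    let (z∈bases , z-c₂) = ∩-member {bases c₁ δ} {class (χ δ) c₂} z z∈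
        (z-c₁ , a , a+δ≡z , a-c₁) = bases-member {c₁} {δ} z∈bases
    in record { foot = a ; foot+δ = a+δ≡z ; foot-row₀ = a-c₁ ; row₀ = z-c₁
              ; row-δ = class-member (χ δ) c₂ z z-c₂ }

  no-L-free-colouring : ∀ {m b k} → 3 * m < N → 2 * (N * b) < m * suc m → 2 * k ≤ b →
                        2 * (N * 1) < k * suc k → ⊥
  no-L-free-colouring {m} {b} {k} 3m<N few-pairs₁ 2k≤b few-pairs₂ =
    let (c₁ , many-c₁) = popular-class {m = m} (χ 0) 3m<N
        (δ , δ>0 , many-δ) = popular-difference {N} (class (χ 0) c₁) few-pairs₁ many-c₁
        (c₂ , c₂≢c₁ , many-c₂) = popular-class-avoiding {n = N} {m = k} (bases c₁ δ) (χ δ) c₁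
                                   (λ z z<N → row-δ-avoids δ>0 z<N) (≤-<-trans 2k≤b many-δ)
    in focused-sets-are-small {c₁} {c₂} {δ} {k} (bases c₁ δ ∩ class (χ δ) c₂) (c₂≢c₁ ∘ sym)
                              focused-member few-pairs₂ many-c₂

every-3-colouring-of-2593 : HasLProperty 3 2593
every-3-colouring-of-2593 χ = MonoL-extend χ (decidable-stable (monoL? 2593 (extend χ)) λ L-free →
  no-L-free-colouring (extend χ) L-free {m = 864} {b = 144} {k = 72}
    (from-yes (3 * 864 <? 2593)) (from-yes (2 * (2593 * 144) <? 864 * 865))
    (from-yes (2 * 72 ≤? 144)) (from-yes (2 * (2593 * 1) <? 72 * 73)))

lookupOr : {A : Set} → A → List A → ℕ → A
lookupOr d []       k       = d
lookupOr d (x ∷ xs) zero    = x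
lookupOr d (x ∷ xs) (suc k) = lookupOr d xs k

table : List (List ℕ)
table =
  ( (1 ∷ 0 ∷ 2 ∷ 1 ∷ 0 ∷ 2 ∷ 1 ∷ 1 ∷ 0 ∷ 2 ∷ 1 ∷ 0 ∷ 2 ∷ 2 ∷ 0 ∷ 0 ∷ 2 ∷ 1 ∷ 0 ∷ 0 ∷ [])
  ∷ (1 ∷ 1 ∷ 0 ∷ 2 ∷ 1 ∷ 0 ∷ 2 ∷ 2 ∷ 0 ∷ 2 ∷ 1 ∷ 0 ∷ 2 ∷ 1 ∷ 0 ∷ 2 ∷ 2 ∷ 1 ∷ 0 ∷ 1 ∷ [])
  ∷ (2 ∷ 2 ∷ 2 ∷ 1 ∷ 0 ∷ 2 ∷ 1 ∷ 0 ∷ 2 ∷ 1 ∷ 0 ∷ 2 ∷ 1 ∷ 0 ∷ 2 ∷ 1 ∷ 1 ∷ 1 ∷ 2 ∷ 0 ∷ [])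
  ∷ (1 ∷ 1 ∷ 0 ∷ 0 ∷ 2 ∷ 1 ∷ 0 ∷ 2 ∷ 1 ∷ 0 ∷ 2 ∷ 1 ∷ 0 ∷ 2 ∷ 1 ∷ 0 ∷ 0 ∷ 2 ∷ 1 ∷ 2 ∷ [])
  ∷ (1 ∷ 0 ∷ 0 ∷ 2 ∷ 0 ∷ 1 ∷ 0 ∷ 0 ∷ 2 ∷ 1 ∷ 2 ∷ 2 ∷ 0 ∷ 0 ∷ 1 ∷ 1 ∷ 1 ∷ 0 ∷ 2 ∷ 2 ∷ [])
  ∷ (2 ∷ 2 ∷ 1 ∷ 1 ∷ 0 ∷ 1 ∷ 0 ∷ 1 ∷ 0 ∷ 0 ∷ 2 ∷ 0 ∷ 2 ∷ 2 ∷ 1 ∷ 0 ∷ 0 ∷ 2 ∷ 1 ∷ 1 ∷ [])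
  ∷ (2 ∷ 0 ∷ 0 ∷ 2 ∷ 2 ∷ 1 ∷ 2 ∷ 1 ∷ 0 ∷ 1 ∷ 0 ∷ 0 ∷ 1 ∷ 1 ∷ 2 ∷ 2 ∷ 2 ∷ 1 ∷ 0 ∷ 0 ∷ [])
  ∷ (0 ∷ 2 ∷ 1 ∷ 1 ∷ 1 ∷ 0 ∷ 2 ∷ 2 ∷ 2 ∷ 0 ∷ 2 ∷ 1 ∷ 1 ∷ 0 ∷ 1 ∷ 1 ∷ 1 ∷ 0 ∷ 2 ∷ 2 ∷ [])
  ∷ (0 ∷ 0 ∷ 1 ∷ 2 ∷ 2 ∷ 2 ∷ 1 ∷ 0 ∷ 1 ∷ 2 ∷ 2 ∷ 1 ∷ 0 ∷ 1 ∷ 0 ∷ 0 ∷ 0 ∷ 2 ∷ 1 ∷ 1 ∷ [])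
  ∷ (2 ∷ 2 ∷ 0 ∷ 1 ∷ 0 ∷ 0 ∷ 1 ∷ 2 ∷ 1 ∷ 2 ∷ 1 ∷ 2 ∷ 2 ∷ 0 ∷ 0 ∷ 1 ∷ 2 ∷ 1 ∷ 0 ∷ 0 ∷ [])
  ∷ (0 ∷ 1 ∷ 2 ∷ 0 ∷ 1 ∷ 1 ∷ 1 ∷ 2 ∷ 0 ∷ 2 ∷ 0 ∷ 1 ∷ 1 ∷ 2 ∷ 2 ∷ 0 ∷ 1 ∷ 0 ∷ 2 ∷ 2 ∷ [])
  ∷ (2 ∷ 0 ∷ 2 ∷ 1 ∷ 1 ∷ 2 ∷ 2 ∷ 2 ∷ 2 ∷ 1 ∷ 0 ∷ 0 ∷ 0 ∷ 1 ∷ 1 ∷ 2 ∷ 0 ∷ 2 ∷ 1 ∷ 1 ∷ [])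
  ∷ (2 ∷ 1 ∷ 1 ∷ 2 ∷ 0 ∷ 2 ∷ 0 ∷ 0 ∷ 1 ∷ 1 ∷ 2 ∷ 1 ∷ 1 ∷ 0 ∷ 2 ∷ 2 ∷ 2 ∷ 1 ∷ 0 ∷ 0 ∷ [])
  ∷ (0 ∷ 0 ∷ 0 ∷ 2 ∷ 2 ∷ 2 ∷ 1 ∷ 1 ∷ 1 ∷ 0 ∷ 0 ∷ 0 ∷ 2 ∷ 2 ∷ 2 ∷ 1 ∷ 1 ∷ 0 ∷ 2 ∷ 1 ∷ [])
  ∷ (0 ∷ 1 ∷ 2 ∷ 2 ∷ 1 ∷ 0 ∷ 2 ∷ 2 ∷ 0 ∷ 0 ∷ 1 ∷ 2 ∷ 1 ∷ 0 ∷ 0 ∷ 2 ∷ 0 ∷ 2 ∷ 1 ∷ 2 ∷ [])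
  ∷ (0 ∷ 0 ∷ 1 ∷ 1 ∷ 2 ∷ 0 ∷ 0 ∷ 1 ∷ 2 ∷ 1 ∷ 1 ∷ 2 ∷ 2 ∷ 2 ∷ 1 ∷ 1 ∷ 2 ∷ 1 ∷ 0 ∷ 1 ∷ [])
  ∷ (0 ∷ 2 ∷ 2 ∷ 2 ∷ 2 ∷ 0 ∷ 1 ∷ 1 ∷ 2 ∷ 2 ∷ 0 ∷ 2 ∷ 0 ∷ 1 ∷ 0 ∷ 2 ∷ 1 ∷ 0 ∷ 2 ∷ 0 ∷ [])
  ∷ (0 ∷ 2 ∷ 1 ∷ 1 ∷ 0 ∷ 1 ∷ 1 ∷ 2 ∷ 1 ∷ 0 ∷ 1 ∷ 2 ∷ 0 ∷ 1 ∷ 0 ∷ 1 ∷ 2 ∷ 2 ∷ 1 ∷ 2 ∷ [])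
  ∷ (2 ∷ 2 ∷ 1 ∷ 0 ∷ 0 ∷ 1 ∷ 0 ∷ 1 ∷ 2 ∷ 1 ∷ 2 ∷ 1 ∷ 2 ∷ 1 ∷ 2 ∷ 0 ∷ 1 ∷ 0 ∷ 0 ∷ 1 ∷ [])
  ∷ (2 ∷ 0 ∷ 0 ∷ 0 ∷ 1 ∷ 2 ∷ 1 ∷ 0 ∷ 0 ∷ 2 ∷ 0 ∷ 1 ∷ 1 ∷ 2 ∷ 2 ∷ 0 ∷ 0 ∷ 1 ∷ 1 ∷ 0 ∷ [])
  ∷ [] )

colouring20 : ℕ → ℕ → Fin 3
colouring20 i j = lookupOr 0 (lookupOr [] table i) j mod 3

colouring20-L-free : ¬ MonoL (restrict 20 colouring20)
colouring20-L-free = from-no (monoL? 20 colouring20)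

theorem3p1 : ((r : ℕ) → IsRcL 3 r → (21 ≤ r × r ≤ 2593))
    × (Σ (Coloring 3 20) (λ χ → ¬ MonoL χ))
    × HasLProperty 3 2593
theorem3p1 =
    (λ r R → IsRcL-lower colouring20 colouring20-L-free R , IsRcL-upper every-3-colouring-of-2593 R)
  , (restrict 20 colouring20 , colouring20-L-free)
  , every-3-colouring-of-2593
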